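{- Let $q$ be a power of $2$ and $a,b\in\mathbb{N}$. If $\lfloor a/q\rfloor$ is even, then $t^{2q^2}[a,b]=[a+q,b]$. If $\lfloor b/q\rfloor$ is even, then $t^{4q^2}[a,b]=[a,b+q]$.
   Context: $\mathbb{N}=\{0,1,2,\dots\}$. Let $g:\mathbb{N}\to\mathbb{N}$ be defined by $g(0)=0$, $g(2n)=4g(n)$, $g(2n+1)=g(2n)+1$. For $a,b\in\mathbb{N}$, $[a,b]$ denotes the monomial $t^{1+2g(a)+4g(b)}\in\mathbb{Z}/2[t]$. -}

module Defs where

open import Data.Nat using (ℕ; zero; suc; _+_; _*_; _∸_; _^_; _≡ᵇ_; _/_; _%_)
open import Data.Bool using (Bool; true; false; _xor_; _∧_)
open import Data.Product using (∃-syntax)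
open import Relation.Binary.PropositionalEquality using (_≡_)

-- g(0)=0, g(2n)=4g(n), g(2n+1)=g(2n)+1, defined via n = 2*(n/2) + n%2
-- by structural recursion on a fuel bound.
g-aux : ℕ → ℕ → ℕ
g-aux zero    n = 0
g-aux (suc f) n = 4 * g-aux f (n / 2) + n % 2

g : ℕ → ℕ
g n = g-aux n n

-- Polynomials over Z/2 as coefficient sequences ℕ → Bool (true = 1).
Poly : Set
Poly = ℕ → Bool

_≈P_ : Poly → Poly → Set
p ≈P r = ∀ k → p k ≡ r k

xsum : ℕ → (ℕ → Bool) → Bool
xsum zero    f = f 0
xsum (suc k) f = xsum k f xor f (suc k)

_·P_ : Poly → Poly → Poly
(p ·P r) k = xsum k (λ i → p i ∧ r (k ∸ i))

t^ : ℕ → Poly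
t^ n k = k ≡ᵇ n

⟦_,_⟧ : ℕ → ℕ → Poly
⟦ a , b ⟧ = t^ (1 + 2 * g a + 4 * g b)

IsPow2 : ℕ → Set
IsPow2 q = ∃[ e ] q ≡ 2 ^ e

-- g n writes the binary digits of n in base 4, i.e. it spreads them to the even bit positions.
-- If q = 2^e and ⌊a/q⌋ is even, then bit e of a is 0, so adding q to a sets that bit without a
-- carry and g (a + q) = g a + q².  Hence the exponent of [a+q,b] exceeds that of [a,b] by 2q²,
-- that of [a,b+q] exceeds it by 4q², and multiplying monomials adds exponents.
module Submission where

open import Defs
open import Data.Nat using (ℕ; zero; suc; _+_; _*_; _∸_; _^_; _/_; _%_; _≡ᵇ_; _≤_; _<_; _≤?_; _≟_; NonZero; z≤n; s≤s)
open import Data.Nat.Properties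
open import Data.Nat.DivMod
open import Data.Nat.Tactic.RingSolver using (solve-∀)
open import Data.Bool using (false; _∧_)
open import Data.Bool.Properties using (xor-identityʳ)
open import Data.Product using (_×_; _,_)
open import Function using (_∘_)
open import Function.Bundles using (mk⇔)
open import Relation.Nullary using (Dec; yes; no; contradiction)
open import Relation.Nullary.Decidable using (dec-true; dec-false; does-⇔)
open import Relation.Binary.PropositionalEquality

g-aux-zero : ∀ f → g-aux f 0 ≡ 0
g-aux-zero zero    = refl
g-aux-zero (suc f) = cong (λ x → 4 * x + 0) (g-aux-zero f)

n≤1+f⇒n/2≤f : ∀ f n → n ≤ suc f → n / 2 ≤ f
n≤1+f⇒n/2≤f f n n≤1+f =
  ≤-pred (≤-trans (s≤s (/-monoˡ-≤ 2 n≤1+f)) (m/n<m (suc f) 2 (s≤s (s≤s z≤n))))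

g-aux-fuel-irrelevant : ∀ f f′ n → n ≤ f → n ≤ f′ → g-aux f n ≡ g-aux f′ n
g-aux-fuel-irrelevant zero     f′       _ z≤n _   = sym (g-aux-zero f′)
g-aux-fuel-irrelevant (suc f)  zero     _ _   z≤n = g-aux-zero (suc f)
g-aux-fuel-irrelevant (suc f)  (suc f′) n n≤f n≤f′ =
  cong (λ x → 4 * x + n % 2)
       (g-aux-fuel-irrelevant f f′ (n / 2) (n≤1+f⇒n/2≤f f n n≤f) (n≤1+f⇒n/2≤f f′ n n≤f′))

g-unfold : ∀ n → g n ≡ 4 * g (n / 2) + n % 2
g-unfold zero    = refl
g-unfold (suc n) = cong (λ x → 4 * x + suc n % 2)
  (g-aux-fuel-irrelevant n (suc n / 2) (suc n / 2) (n≤1+f⇒n/2≤f n (suc n) ≤-refl) ≤-refl)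

g-digit : ∀ r y → r < 2 → g (r + y * 2) ≡ 4 * g y + r
g-digit r y r<2 = begin
  g (r + y * 2)                                 ≡⟨ g-unfold (r + y * 2) ⟩
  4 * g ((r + y * 2) / 2) + (r + y * 2) % 2     ≡⟨ cong₂ (λ u v → 4 * g u + v) quotient remainder ⟩
  4 * g y + r                                   ∎
  where
  open ≡-Reasoning
  r%2≡r : r % 2 ≡ r
  r%2≡r = m<n⇒m%n≡m r<2
  remainder : (r + y * 2) % 2 ≡ r
  remainder = trans ([m+kn]%n≡m%n r y 2) r%2≡r
  no-carry : r % 2 + (y * 2) % 2 < 2
  no-carry = subst (_< 2) (sym (trans (cong₂ _+_ r%2≡r (m*n%n≡0 y 2)) (+-identityʳ r))) r<2
  quotient : (r + y * 2) / 2 ≡ y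
  quotient = trans (+-distrib-/ r (y * 2) no-carry) (cong₂ _+_ (m<n⇒m/n≡0 r<2) (m*n/n≡m y 2))

g-+-2^ : ∀ e a → ((a / 2 ^ e) {{m^n≢0 2 e}}) % 2 ≡ 0 → g (a + 2 ^ e) ≡ g a + 2 ^ e * 2 ^ e
g-+-2^ zero a even = begin
  g (a + 1)              ≡⟨ cong (λ x → g (x + 1)) a≡m*2 ⟩
  g (m * 2 + 1)          ≡⟨ cong g (+-comm (m * 2) 1) ⟩
  g (1 + m * 2)          ≡⟨ g-digit 1 m (s≤s (s≤s z≤n)) ⟩
  4 * g m + 1            ≡⟨ cong (_+ 1) (trans (g-digit 0 m (s≤s z≤n)) (+-identityʳ _)) ⟨
  g (m * 2) + 1          ≡⟨ cong (λ x → g x + 1) a≡m*2 ⟨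
  g a + 1                ∎
  where
  open ≡-Reasoning
  m = a / 2
  a≡m*2 : a ≡ m * 2
  a≡m*2 = trans (m≡m%n+[m/n]*n a 2) (cong (_+ m * 2) (trans (cong (_% 2) (sym (n/1≡n a))) even))
g-+-2^ (suc e) a even = begin
  g (a + 2 * Q)                     ≡⟨ cong g (trans (cong (_+ 2 * Q) a≡r+m*2) (shift-digit r m Q)) ⟩
  g (r + (m + Q) * 2)               ≡⟨ g-digit r (m + Q) r<2 ⟩
  4 * g (m + Q) + r                 ≡⟨ cong (λ x → 4 * x + r) (g-+-2^ e m m-even) ⟩
  4 * (g m + Q * Q) + r             ≡⟨ regroup (g m) Q r ⟩
  (4 * g m + r) + 2 * Q * (2 * Q)   ≡⟨ cong (_+ 2 * Q * (2 * Q)) (g-digit r m r<2) ⟨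
  g (r + m * 2) + 2 * Q * (2 * Q)   ≡⟨ cong (λ x → g x + 2 * Q * (2 * Q)) a≡r+m*2 ⟨
  g a + 2 * Q * (2 * Q)             ∎
  where
  open ≡-Reasoning
  Q = 2 ^ e
  instance
    Q≢0 : NonZero Q
    Q≢0 = m^n≢0 2 e
  m = a / 2
  r = a % 2
  r<2 : r < 2
  r<2 = m%n<n a 2
  a≡r+m*2 : a ≡ r + m * 2
  a≡r+m*2 = m≡m%n+[m/n]*n a 2
  m-even : (m / Q) % 2 ≡ 0
  m-even = trans (cong (_% 2) (m/n/o≡m/[n*o] a 2 Q {{_}} {{_}} {{m^n≢0 2 (suc e)}})) even
  shift-digit : ∀ r m q → (r + m * 2) + 2 * q ≡ r + (m + q) * 2
  shift-digit = solve-∀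
  regroup : ∀ x q r → 4 * (x + q * q) + r ≡ (4 * x + r) + 2 * q * (2 * q)
  regroup = solve-∀

xsum-vanishing : ∀ f m k → (∀ i → i ≢ m → f i ≡ false) → k < m → xsum k f ≡ false
xsum-vanishing f m zero    supp k<m = supp 0 (λ 0≡m → <-irrefl 0≡m k<m)
xsum-vanishing f m (suc k) supp k<m
  rewrite xsum-vanishing f m k supp (<-trans (n<1+n k) k<m) = supp (suc k) (λ k≡m → <-irrefl k≡m k<m)

xsum-point : ∀ f m k → (∀ i → i ≢ m → f i ≡ false) → m ≤ k → xsum k f ≡ f m
xsum-point f m k supp m≤k with m ≟ k
xsum-point f m zero    supp m≤k | yes refl = refl
xsum-point f m (suc k) supp m≤k | yes refl
  rewrite xsum-vanishing f (suc k) k supp (n<1+n k) = refl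
xsum-point f m zero    supp m≤k | no m≢k = contradiction (n≤0⇒n≡0 m≤k) m≢k
xsum-point f m (suc k) supp m≤k | no m≢k
  rewrite xsum-point f m k supp (≤-pred (≤∧≢⇒< m≤k m≢k)) | supp (suc k) (m≢k ∘ sym)
  = xor-identityʳ (f m)

t^-·P-t^ : ∀ m n → (t^ m ·P t^ n) ≈P t^ (m + n)
t^-·P-t^ m n k = by-cases (m ≤? k)
  where
  open ≡-Reasoning
  coeff = λ i → (i ≡ᵇ m) ∧ (k ∸ i ≡ᵇ n)
  supported : ∀ i → i ≢ m → coeff i ≡ false
  supported i i≢m rewrite dec-false (i ≟ m) i≢m = refl
  by-cases : Dec (m ≤ k) → xsum k coeff ≡ (k ≡ᵇ m + n)
  by-cases (yes m≤k) = begin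
    xsum k coeff                ≡⟨ xsum-point coeff m k supported m≤k ⟩
    (m ≡ᵇ m) ∧ (k ∸ m ≡ᵇ n)     ≡⟨ cong (_∧ (k ∸ m ≡ᵇ n)) (dec-true (m ≟ m) refl) ⟩
    (k ∸ m ≡ᵇ n)                ≡⟨ does-⇔ (mk⇔ to from) (k ∸ m ≟ n) (k ≟ m + n) ⟩
    (k ≡ᵇ m + n)                ∎
    where
    to : k ∸ m ≡ n → k ≡ m + n
    to k∸m≡n = trans (sym (m+[n∸m]≡n m≤k)) (cong (m +_) k∸m≡n)
    from : k ≡ m + n → k ∸ m ≡ n
    from k≡m+n = trans (cong (_∸ m) k≡m+n) (m+n∸m≡n m n)
  by-cases (no m≰k) = begin
    xsum k coeff                ≡⟨ xsum-vanishing coeff m k supported (≰⇒> m≰k) ⟩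
    false                       ≡⟨ dec-false (k ≟ m + n) k≢m+n ⟨
    (k ≡ᵇ m + n)                ∎
    where
    k≢m+n : k ≢ m + n
    k≢m+n k≡m+n = m≰k (subst (m ≤_) (sym k≡m+n) (m≤m+n m n))

theorem2p1 : (q a b : ℕ) → .{{_ : NonZero q}} → IsPow2 q →
    ((a / q) % 2 ≡ 0 → (t^ (2 * (q * q)) ·P ⟦ a , b ⟧) ≈P ⟦ a + q , b ⟧)
    × ((b / q) % 2 ≡ 0 → (t^ (4 * (q * q)) ·P ⟦ a , b ⟧) ≈P ⟦ a , b + q ⟧)
theorem2p1 .(2 ^ e) a b (e , refl) =
    (λ a-even → t^-·P-t^-≡ (trans (regroup-a (g a) (g b) (Q * Q))
                                  (cong (λ x → 1 + 2 * x + 4 * g b) (sym (g-+-2^ e a a-even)))))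
  , (λ b-even → t^-·P-t^-≡ (trans (regroup-b (g a) (g b) (Q * Q))
                                  (cong (λ x → 1 + 2 * g a + 4 * x) (sym (g-+-2^ e b b-even)))))
  where
  Q = 2 ^ e
  t^-·P-t^-≡ : ∀ {m n p} → m + n ≡ p → (t^ m ·P t^ n) ≈P t^ p
  t^-·P-t^-≡ {m} {n} refl = t^-·P-t^ m n
  regroup-a : ∀ x y s → 2 * s + (1 + 2 * x + 4 * y) ≡ 1 + 2 * (x + s) + 4 * y
  regroup-a = solve-∀
  regroup-b : ∀ x y s → 4 * s + (1 + 2 * x + 4 * y) ≡ 1 + 2 * x + 4 * (y + s)
  regroup-b = solve-∀
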